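{- Let $\Theta=(\theta_n)_{n\in\omega}\subseteq 2^{<\omega}$ with $|\theta_n|=n$ for all $n$. Then: (a) for each $n\in\omega$, the set $2^n$ is $s(\mathfrak{R}_\Theta)$-connected; (b) the relation $s(\mathfrak{R}_\Theta)$ is acyclic; (c) if $e,e'\in 2^n$ and $l<n$ is maximal with $e(l)\neq e'(l)$, and $p_{e,e'}=(f_j)_{j\le m}$ is the unique $s(\mathfrak{R}_\Theta)$-path without repetition from $e$ to $e'$, then there is exactly one $j<m$ with $f_j(l)\neq f_{j+1}(l)$, and every $k<n$ for which there is some $j<m$ with $f_j(k)\neq f_{j+1}(k)$ satisfies $k\le l$.
   Context: $\mathfrak{R}_\Theta$ is the relation on $2^{<\omega}$ given by: $(e,e')\in\mathfrak{R}_\Theta$ iff $e=e'$, or there are $n\in\omega$ and $w\in 2^{<\omega}$ with $(e,e')=(\theta_n0w,\theta_n1w)$. For a relation $R$, $R^{ -1}:=\{(y,x):(x,y)\in R\}$ and $s(R):=R\cup R^{ -1}$. For a relation $R$ on a set $E$: an $R$-path is a finite sequence $(e_i)_{i\le n}$ with $(e_i,e_{i+1})\in R$ for $i<n$; $E$ is $R$-connected if for all $e,e'\in E$ there is an $R$-path in $E$ from $e$ to $e'$; an $R$-cycle is an $R$-path $(e_i)_{i\le n}$ with $n\ge 3$ such that for $0\le i\neq j\le n$, $e_i=e_j$ iff $\{i,j\}=\{0,n\}$; $R$ is acyclic if there is no $R$-cycle. If $R$ is symmetric and acyclic and there is an $R$-path from $e$ to $e'$, then there is a unique $R$-path without repetition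 from $e$ to $e'$, denoted $p_{e,e'}$. -}

module Defs where

open import Data.Nat using (ℕ; zero; suc; _<_; _≥_)
open import Data.Bool using (Bool; true; false)
open import Data.List using (List; []; _∷_; _++_; length)
open import Data.Maybe using (Maybe; just; nothing)
open import Data.Fin using (Fin; zero; suc; fromℕ; inject₁)
open import Data.Product using (Σ; _×_; _,_; ∃-syntax)
open import Data.Sum using (_⊎_)
open import Relation.Binary.PropositionalEquality using (_≡_; _≢_)
open import Relation.Nullary using (¬_)

Str : Set
Str = List Bool

_at_ : Str → ℕ → Maybe Bool
[]      at _     = nothing
(b ∷ e) at zero  = just b
(b ∷ e) at suc l = e at l

In2^ : ℕ → Str → Set
In2^ n e = length e ≡ n

Rel : Set₁
Rel = Str → Str → Set

RΘ : (ℕ → Str) → Rel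
RΘ θ e e' = (e ≡ e') ⊎ (Σ ℕ λ n → Σ Str λ w →
              (e ≡ θ n ++ (false ∷ w)) × (e' ≡ θ n ++ (true ∷ w)))

sym-closure : Rel → Rel
sym-closure R x y = R x y ⊎ R y x

record Path (R : Rel) : Set where
  constructor path
  field
    len   : ℕ
    vert  : Fin (suc len) → Str
    steps : (i : Fin len) → R (vert (inject₁ i)) (vert (suc i))

open Path public

start : ∀ {R} → Path R → Str
start p = vert p zero

end : ∀ {R} → Path R → Str
end p = vert p (fromℕ (len p))

Connected : Rel → (Str → Set) → Set
Connected R E = ∀ e e' → E e → E e' →
  Σ (Path R) λ p → (start p ≡ e) × (end p ≡ e') × (∀ i → E (vert p i))

NoRepetition : ∀ {R} → Path R → Set
NoRepetition p = ∀ i j → vert p i ≡ vert p j → i ≡ j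

IsCycle : ∀ {R} → Path R → Set
IsCycle p = (len p ≥ 3) × (∀ i j → i ≢ j →
  (vert p i ≡ vert p j) ⇔' (((i ≡ zero) × (j ≡ fromℕ (len p))) ⊎ ((i ≡ fromℕ (len p)) × (j ≡ zero))))
  where
  _⇔'_ : Set → Set → Set
  A ⇔' B = (A → B) × (B → A)

Acyclic : Rel → Set
Acyclic R = ¬ (Σ (Path R) IsCycle)

module Submission where

-- A step of s(𝔯_Θ) between distinct strings changes exactly one bit k, and since |θ_k| = k it is then
-- the edge {θ_k0w, θ_k1w}, which is determined by k and the bits above k.  Hence along a
-- repetition-free path on which no bit above k ever changes, bit k changes at most once: two such
-- changes would traverse the same edge, in the same or the opposite direction.  Descending from the
-- top bit, a repetition-free path whose ends agree above l changes no bit above l, and it changes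
-- bit l exactly once if its ends differ there.  A cycle, with its closing edge removed, is a
-- repetition-free path whose ends differ exactly at the bit k flipped by that edge; its unique
-- change of bit k must be the same edge, which forces the cycle to have length 2.  Connectivity of
-- 2^(n+1) follows from that of 2^n by splitting off the last bit and crossing along θ_n0 — θ_n1.

open import Defs
open import Data.Bool using (Bool; true; false; not)
open import Data.Bool.Properties using (not-¬)
import Data.Bool as Bool
open import Data.Fin using (Fin; zero; suc; toℕ; inject₁; fromℕ)
open import Data.Fin.Properties using (toℕ-inject₁; inject₁-injective; fromℕ≢inject₁; ¬∀⟶∃¬)
import Data.Fin.Properties as Fin
open import Data.List using ([]; _∷_; _++_; _∷ʳ_; [_]; length; _∷ʳ′_; initLast)
open import Data.List.Properties using (length-++; length-++-comm; ++-assoc)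
open import Data.Maybe using (just; nothing)
open import Data.Maybe.Properties using (just-injective; ≡-dec)
open import Data.Nat using (ℕ; zero; suc; _+_; _<_; _≤_; z≤n; s≤s; _≤?_; _<?_)
open import Data.Nat.Properties
  using (+-suc; +-identityʳ; +-monoˡ-≤; ≤-trans; ≤-reflexive; m≤m+n; m≤n+m; <-trans; <-irrefl; ≰⇒>; ≮⇒≥)
import Data.Nat.Properties as ℕ
open import Data.Product using (Σ; _×_; _,_; proj₁; proj₂; map₂; ∃-syntax)
open import Data.Sum using (_⊎_; inj₁; inj₂)
import Data.Sum as Sum
open import Function using (_∘_)
open import Relation.Binary.Construct.Closure.ReflexiveTransitive using (Star; ε; _◅_; _◅◅_; gmap)
open import Relation.Binary.PropositionalEquality
  using (_≡_; _≢_; refl; sym; trans; cong; cong₂; subst; module ≡-Reasoning)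
open import Relation.Nullary using (¬_; Dec; yes; no; contradiction)

open ≡-Reasoning

at-≥length : ∀ (x : Str) {k} → length x ≤ k → x at k ≡ nothing
at-≥length []      _         = refl
at-≥length (b ∷ x) (s≤s len) = at-≥length x len

at-extensional : ∀ (x y : Str) → (∀ i → x at i ≡ y at i) → x ≡ y
at-extensional []      []      _  = refl
at-extensional []      (_ ∷ _) eq with () ← eq 0
at-extensional (_ ∷ _) []      eq with () ← eq 0
at-extensional (b ∷ x) (c ∷ y) eq =
  cong₂ _∷_ (just-injective (eq 0)) (at-extensional x y (eq ∘ suc))

at-++-length : ∀ (t : Str) b w → (t ++ b ∷ w) at length t ≡ just b
at-++-length []      b w = refl
at-++-length (_ ∷ t) b w = at-++-length t b w

at-++-≢length : ∀ (t : Str) b b' w {k} → k ≢ length t → (t ++ b ∷ w) at k ≡ (t ++ b' ∷ w) at k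
at-++-≢length []      b b' w {zero}  k≢0 = contradiction refl k≢0
at-++-≢length []      b b' w {suc k} _   = refl
at-++-≢length (_ ∷ t) b b' w {zero}  _   = refl
at-++-≢length (_ ∷ t) b b' w {suc k} k≢  = at-++-≢length t b b' w (k≢ ∘ cong suc)

at-++-beyond : ∀ (t : Str) b w i → (t ++ b ∷ w) at suc (length t + i) ≡ w at i
at-++-beyond []      b w i = refl
at-++-beyond (_ ∷ t) b w i = at-++-beyond t b w i

bits-agree-above : ∀ {n l} (x y : Str) → In2^ n x → In2^ n y →
  (∀ k → l < k → k < n → x at k ≡ y at k) → ∀ k → l < k → x at k ≡ y at k
bits-agree-above {n} x y |x| |y| agree k l<k with k <? n
... | yes k<n = agree k l<k k<n
... | no k≮n  = trans (beyond x |x|) (sym (beyond y |y|))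
  where
  beyond : ∀ z → In2^ n z → z at k ≡ nothing
  beyond z |z| = at-≥length z (subst (_≤ k) (sym |z|) (≮⇒≥ k≮n))

module _ {A B : Set} (f : A → B) where

  Preserved : ∀ {m} → (Fin (suc m) → A) → Fin m → Set
  Preserved v j = f (v (inject₁ j)) ≡ f (v (suc j))

  preserved-upto : ∀ {m} (v : Fin (suc m) → A) i →
    (∀ j → toℕ j < toℕ i → Preserved v j) → f (v zero) ≡ f (v i)
  preserved-upto v zero _ = refl
  preserved-upto {suc m} v (suc i) pres =
    trans (pres zero (s≤s z≤n)) (preserved-upto (v ∘ suc) i (λ j j<i → pres (suc j) (s≤s j<i)))

  preserved-from : ∀ {m} (v : Fin (suc m) → A) i →
    (∀ j → toℕ i ≤ toℕ j → Preserved v j) → f (v i) ≡ f (v (fromℕ m))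
  preserved-from {zero}  v zero    _    = refl
  preserved-from {suc m} v zero    pres =
    trans (pres zero z≤n) (preserved-from (v ∘ suc) zero (λ j _ → pres (suc j) z≤n))
  preserved-from {suc m} v (suc i) pres = preserved-from (v ∘ suc) i (λ j i≤j → pres (suc j) (s≤s i≤j))

  preserved : ∀ {m} (v : Fin (suc m) → A) i → (∀ j → Preserved v j) → f (v zero) ≡ f (v i)
  preserved v i pres = preserved-upto v i (λ j _ → pres j)

inject₁≡suc⇒suc≢inject₁ : ∀ {m} {j j' : Fin m} → inject₁ j ≡ suc j' → suc j ≢ inject₁ j'
inject₁≡suc⇒suc≢inject₁ {j = suc j} {suc j'} e e' =
  inject₁≡suc⇒suc≢inject₁ (Fin.suc-injective e) (Fin.suc-injective e')

first-step-to-last⇒m≡1 : ∀ {m} {j : Fin m} → inject₁ j ≡ zero → suc j ≡ fromℕ m → m ≡ 1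
first-step-to-last⇒m≡1 {suc zero} {zero} refl refl = refl

Keeps : ∀ {R} → ℕ → (p : Path R) → Fin (len p) → Set
Keeps k p = Preserved (_at k) (vert p)

keeps? : ∀ {R} k (p : Path R) j → Dec (Keeps k p j)
keeps? k p j = ≡-dec Bool._≟_ _ _

FrozenAbove : ∀ {R} → ℕ → Path R → Set
FrozenAbove k p = ∀ i → k < i → ∀ j → Keeps i p j

frozenAbove-agree : ∀ {R k} (p : Path R) → FrozenAbove k p →
                    ∀ a b {i} → k < i → vert p a at i ≡ vert p b at i
frozenAbove-agree p frozen a b {i} k<i =
  trans (sym (preserved (_at i) (vert p) a (frozen i k<i))) (preserved (_at i) (vert p) b (frozen i k<i))

ends-differ⇒change : ∀ {R k} (p : Path R) → start p at k ≢ end p at k → ∃[ j ] ¬ Keeps k p j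
ends-differ⇒change {k = k} p differ =
  ¬∀⟶∃¬ (len p) (Keeps k p) (keeps? k p) (differ ∘ preserved (_at k) (vert p) (fromℕ (len p)))

prepend : ∀ {R x} (p : Path R) → R x (start p) → Path R
prepend {R} {x} p r = path (suc (len p)) vertices steps′
  where
  vertices : Fin (suc (suc (len p))) → Str
  vertices zero    = x
  vertices (suc i) = vert p i
  steps′ : ∀ i → R (vertices (inject₁ i)) (vertices (suc i))
  steps′ zero    = r
  steps′ (suc i) = steps p i

star⇒path : ∀ {R x y} → Star R x y → Σ (Path R) λ p → start p ≡ x × end p ≡ y
star⇒path {x = x} ε = path 0 (λ _ → x) (λ ()) , refl , refl
star⇒path (r ◅ rs) with star⇒path rs
... | p , refl , p-end = prepend p r , refl , p-end

module OpenedCycle {R : Rel} {M} (v : Fin (suc (suc (suc M))) → Str)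
                   (st : ∀ i → R (v (inject₁ i)) (v (suc i)))
                   (cycle : IsCycle {R} (path (suc (suc M)) v st)) where

  opened : Path R
  opened = path (suc M) (v ∘ inject₁) (st ∘ inject₁)

  opened-noRepetition : NoRepetition opened
  opened-noRepetition a b va≡vb with a Fin.≟ b
  ... | yes a≡b = a≡b
  ... | no a≢b with proj₁ (proj₂ cycle (inject₁ a) (inject₁ b) (a≢b ∘ inject₁-injective)) va≡vb
  ...   | inj₁ (_ , b≡last) = contradiction (sym b≡last) fromℕ≢inject₁
  ...   | inj₂ (a≡last , _) = contradiction (sym a≡last) fromℕ≢inject₁

  opened-closing : R (end opened) (start opened)
  opened-closing = subst (R (end opened)) (sym closed) (st (fromℕ (suc M)))
    where
    closed : v zero ≡ v (fromℕ (suc (suc M)))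
    closed = proj₂ (proj₂ cycle zero (fromℕ (suc (suc M))) λ ()) (inj₁ (refl , refl))

  opened-ends-distinct : end opened ≢ start opened
  opened-ends-distinct ends≡ with proj₁ (proj₂ cycle (inject₁ (fromℕ (suc M))) zero λ ()) ends≡
  ... | inj₂ (last≡ , _) = fromℕ≢inject₁ (sym last≡)

module _ (θ : ℕ → Str) (|θ| : ∀ n → length (θ n) ≡ n) where

  S : Rel
  S = sym-closure (RΘ θ)

  at-θ : ∀ k b w → (θ k ++ b ∷ w) at k ≡ just b
  at-θ k b w = subst (λ i → (θ k ++ b ∷ w) at i ≡ just b) (|θ| k) (at-++-length (θ k) b w)

  at-θ-≢ : ∀ k b b' w {i} → i ≢ k → (θ k ++ b ∷ w) at i ≡ (θ k ++ b' ∷ w) at i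
  at-θ-≢ k b b' w i≢k = at-++-≢length (θ k) b b' w (λ i≡|θk| → i≢k (trans i≡|θk| (|θ| k)))

  suffix-unique : ∀ k b b' w w' → (∀ i → k < i → (θ k ++ b ∷ w) at i ≡ (θ k ++ b' ∷ w') at i) → w ≡ w'
  suffix-unique k b b' w w' agree = at-extensional w w' λ i → begin
    w at i                                     ≡⟨ at-++-beyond (θ k) b w i ⟨
    (θ k ++ b ∷ w) at suc (length (θ k) + i)   ≡⟨ agree _ (above i) ⟩
    (θ k ++ b' ∷ w') at suc (length (θ k) + i) ≡⟨ at-++-beyond (θ k) b' w' i ⟩
    w' at i                                    ∎
    where
    above : ∀ i → k < suc (length (θ k) + i)
    above i = subst (λ n → k < suc (n + i)) (sym (|θ| k)) (s≤s (m≤m+n k i))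

  Flip : ℕ → Str → Str → Set
  Flip k x y = Σ Bool λ b → Σ Str λ w → (x ≡ θ k ++ b ∷ w) × (y ≡ θ k ++ not b ∷ w)

  Flip⇒changes : ∀ {k x y} → Flip k x y → x at k ≢ y at k
  Flip⇒changes {k} (b , w , refl , refl) eq =
    not-¬ refl (just-injective (trans (sym (at-θ k b w)) (trans eq (at-θ k (not b) w))))

  Flip⇒keeps : ∀ {k x y i} → Flip k x y → i ≢ k → x at i ≡ y at i
  Flip⇒keeps {k} (b , w , refl , refl) = at-θ-≢ k b (not b) w

  step⇒Flip : ∀ {x y} → S x y → x ≢ y → ∃[ k ] Flip k x y
  step⇒Flip (inj₁ (inj₁ refl))                  x≢y = contradiction refl x≢y
  step⇒Flip (inj₁ (inj₂ (k , w , refl , refl))) _   = k , false , w , refl , refl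
  step⇒Flip (inj₂ (inj₁ refl))                  x≢y = contradiction refl x≢y
  step⇒Flip (inj₂ (inj₂ (k , w , refl , refl))) _   = k , true , w , refl , refl

  step-changing⇒Flip : ∀ {k x y} → S x y → x at k ≢ y at k → Flip k x y
  step-changing⇒Flip {k} s changes with step⇒Flip s (changes ∘ cong (_at k))
  ... | k' , flip with k ℕ.≟ k'
  ...   | yes refl = flip
  ...   | no k≢k'  = contradiction (Flip⇒keeps flip k≢k') changes

  Flip-unique : ∀ {k x y x' y'} → Flip k x y → Flip k x' y' → (∀ i → k < i → x at i ≡ x' at i) →
                (x ≡ x' × y ≡ y') ⊎ (x ≡ y' × y ≡ x')
  Flip-unique {k} (b , w , refl , refl) (b' , w' , refl , refl) agree
    with refl ← suffix-unique k b b' w w' agree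
    with b | b'
  ... | false | false = inj₁ (refl , refl)
  ... | false | true  = inj₂ (refl , refl)
  ... | true  | false = inj₂ (refl , refl)
  ... | true  | true  = inj₁ (refl , refl)

  step-length : ∀ {x y} → S x y → length x ≡ length y
  step-length (inj₁ (inj₁ refl))                  = refl
  step-length (inj₁ (inj₂ (k , w , refl , refl))) = trans (length-++ (θ k)) (sym (length-++ (θ k)))
  step-length (inj₂ (inj₁ refl))                  = refl
  step-length (inj₂ (inj₂ (k , w , refl , refl))) = trans (length-++ (θ k)) (sym (length-++ (θ k)))

  vert-length : ∀ (p : Path S) i → length (start p) ≡ length (vert p i)
  vert-length p i = preserved length (vert p) i (step-length ∘ steps p)

  module _ (p : Path S) (nr : NoRepetition p) where

    change-unique : ∀ {k} → FrozenAbove k p → ∀ {j j'} → ¬ Keeps k p j → ¬ Keeps k p j' → j ≡ j'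
    change-unique frozen {j} {j'} changes changes'
      with Flip-unique (step-changing⇒Flip (steps p j) changes) (step-changing⇒Flip (steps p j') changes')
                       (λ _ → frozenAbove-agree p frozen (inject₁ j) (inject₁ j'))
    ... | inj₁ (same , _)       = inject₁-injective (nr _ _ same)
    ... | inj₂ (cross , cross') = contradiction (nr _ _ cross') (inject₁≡suc⇒suc≢inject₁ (nr _ _ cross))

    change⇒ends-differ : ∀ {k} → FrozenAbove k p → ∀ {j} → ¬ Keeps k p j → start p at k ≢ end p at k
    change⇒ends-differ {k} frozen {j} changes ends-agree = changes (begin
      vert p (inject₁ j) at k ≡⟨ preserved-upto (_at k) (vert p) (inject₁ j) before ⟨
      start p at k            ≡⟨ ends-agree ⟩
      end p at k              ≡⟨ preserved-from (_at k) (vert p) (suc j) after ⟨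
      vert p (suc j) at k     ∎)
      where
      others-keep : ∀ j' → j' ≢ j → Keeps k p j'
      others-keep j' j'≢j with keeps? k p j'
      ... | yes keeps   = keeps
      ... | no changes' = contradiction (change-unique frozen changes' changes) j'≢j
      before : ∀ j' → toℕ j' < toℕ (inject₁ j) → Keeps k p j'
      before j' j'<j = others-keep j' λ { refl → <-irrefl (sym (toℕ-inject₁ j')) j'<j }
      after : ∀ j' → toℕ (suc j) ≤ toℕ j' → Keeps k p j'
      after j' j<j' = others-keep j' λ { refl → <-irrefl refl j<j' }

    -- Downward induction on k, starting from the common length of the strings,
    -- above which every bit is nothing.
    frozenAbove : ∀ {l} → (∀ k → l < k → start p at k ≡ end p at k) → FrozenAbove l p
    frozenAbove {l} ends-agree k l<k = frozen-from (length (start p)) k (m≤n+m _ k) l<k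
      where
      frozen-from : ∀ d k → length (start p) ≤ k + d → l < k → ∀ j → Keeps k p j
      frozen-from zero k n≤k _ j = trans (beyond (inject₁ j)) (sym (beyond (suc j)))
        where
        beyond : ∀ i → vert p i at k ≡ nothing
        beyond i = at-≥length (vert p i)
          (subst (_≤ k) (vert-length p i) (subst (length (start p) ≤_) (+-identityʳ k) n≤k))
      frozen-from (suc d) k n≤k+d l<k j with keeps? k p j
      ... | yes keeps  = keeps
      ... | no changes = contradiction (ends-agree k l<k) (change⇒ends-differ frozen changes)
        where
        frozen : FrozenAbove k p
        frozen i k<i = frozen-from d i
          (≤-trans n≤k+d (≤-trans (≤-reflexive (+-suc k d)) (+-monoˡ-≤ d k<i))) (<-trans l<k k<i)

    highest-change : ∀ {l} → start p at l ≢ end p at l → (∀ k → l < k → start p at k ≡ end p at k) →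
      (Σ (Fin (len p)) λ j → ¬ Keeps l p j × (∀ j' → ¬ Keeps l p j' → j' ≡ j))
      × (∀ k → (∃[ j ] ¬ Keeps k p j) → k ≤ l)
    highest-change {l} differ ends-agree with j , changes ← ends-differ⇒change p differ =
      (j , changes , λ j' changes' → change-unique frozen changes' changes) , below
      where
      frozen : FrozenAbove l p
      frozen = frozenAbove ends-agree
      below : ∀ k → (∃[ j ] ¬ Keeps k p j) → k ≤ l
      below k (j , changes) with k ≤? l
      ... | yes k≤l = k≤l
      ... | no k≰l  = contradiction (frozen k (≰⇒> k≰l) j) changes

    ends-adjacent⇒len≡1 : S (end p) (start p) → end p ≢ start p → len p ≡ 1
    ends-adjacent⇒len≡1 edge distinct
      with k , flip ← step⇒Flip edge distinct
      with j , changes ← ends-differ⇒change p (Flip⇒changes flip ∘ sym)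
      with Flip-unique (step-changing⇒Flip (steps p j) changes) flip
             (λ _ → frozenAbove-agree p frozen (inject₁ j) (fromℕ (len p)))
      where
      frozen : FrozenAbove k p
      frozen = frozenAbove (λ i k<i → sym (Flip⇒keeps flip (λ { refl → <-irrefl refl k<i })))
    ... | inj₁ (_ , to-start)   with () ← nr _ _ to-start
    ... | inj₂ (from-start , to-end) = first-step-to-last⇒m≡1 (nr _ _ from-start) (nr _ _ to-end)

  acyclic : Acyclic S
  acyclic (path _ v st , cycle@(s≤s (s≤s (s≤s z≤n)) , _)) =
    contradiction (ends-adjacent⇒len≡1 opened opened-noRepetition opened-closing opened-ends-distinct) λ ()
    where open OpenedCycle {R = S} v st cycle

  ∷ʳ-step : ∀ c {x y} → S x y → S (x ∷ʳ c) (y ∷ʳ c)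
  ∷ʳ-step c = Sum.map ∷ʳ-RΘ ∷ʳ-RΘ
    where
    ∷ʳ-RΘ : ∀ {x y} → RΘ θ x y → RΘ θ (x ∷ʳ c) (y ∷ʳ c)
    ∷ʳ-RΘ (inj₁ refl)                  = inj₁ refl
    ∷ʳ-RΘ (inj₂ (k , w , refl , refl)) =
      inj₂ (k , w ∷ʳ c , ++-assoc (θ k) (false ∷ w) [ c ] , ++-assoc (θ k) (true ∷ w) [ c ])

  crossing : ∀ n c c' → Star S (θ n ∷ʳ c) (θ n ∷ʳ c')
  crossing n false false = ε
  crossing n false true  = inj₁ (inj₂ (n , [] , refl , refl)) ◅ ε
  crossing n true  false = inj₂ (inj₂ (n , [] , refl , refl)) ◅ ε
  crossing n true  true  = ε

  walk : ∀ n x y → In2^ n x → In2^ n y → Star S x y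
  walk zero    [] [] _ _ = ε
  walk (suc n) x  y |x| |y| with initLast x | initLast y
  ... | x' ∷ʳ′ c | y' ∷ʳ′ c' =
    gmap (_∷ʳ c) (∷ʳ-step c) (walk n x' (θ n) (init-length x' |x|) (|θ| n))
    ◅◅ crossing n c c'
    ◅◅ gmap (_∷ʳ c') (∷ʳ-step c') (walk n (θ n) y' (|θ| n) (init-length y' |y|))
    where
    init-length : ∀ (z : Str) {b} → length (z ∷ʳ b) ≡ suc n → length z ≡ n
    init-length z {b} |z∷b| = ℕ.suc-injective (trans (length-++-comm [ b ] z) |z∷b|)

  connected : ∀ n → Connected S (In2^ n)
  connected n e e' |e| |e'| with star⇒path (walk n e e' |e| |e'|)
  ... | p , refl , p-end = p , refl , p-end , λ i → trans (sym (vert-length p i)) |e|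

proposition18 : (θ : ℕ → Str) → (∀ n → length (θ n) ≡ n) →
    ((n : ℕ) → Connected (sym-closure (RΘ θ)) (In2^ n))
    × Acyclic (sym-closure (RΘ θ))
    × ((n : ℕ) (e e' : Str) → In2^ n e → In2^ n e' →
       (l : ℕ) → l < n → (e at l) ≢ (e' at l) →
       (∀ k → l < k → k < n → (e at k) ≡ (e' at k)) →
       (p : Path (sym-closure (RΘ θ))) → start p ≡ e → end p ≡ e' → NoRepetition p →
       (Σ (Fin (len p)) λ j →
          ((vert p (inject₁ j) at l) ≢ (vert p (suc j) at l))
          × (∀ j' → (vert p (inject₁ j') at l) ≢ (vert p (suc j') at l) → j' ≡ j))
       × (∀ k → k < n → (Σ (Fin (len p)) λ j → (vert p (inject₁ j) at k) ≢ (vert p (suc j) at k)) → k ≤ l))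
proposition18 θ |θ| =
  connected θ |θ| ,
  acyclic θ |θ| ,
  λ { n e e' |e| |e'| l _ differ agree p refl refl nr →
        map₂ (λ below k _ → below k)
             (highest-change θ |θ| p nr differ (bits-agree-above e e' |e| |e'| agree)) }
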